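{- Let $A$ be a set and $F:\mathrm{Set}\to\mathrm{Set}$ the functor $FX=A\times X$. (i) For every endofunctor $G$ on $\mathrm{Set}$, the functor $\mathbb F(G)=(A\times G(-))^{A^{(-)}}$, together with the natural transformation $\epsilon:\mathbb F(G)F\Rightarrow FG$ given by $\epsilon_X(\varphi)=(\mathrm{id}\times G\pi_2)(\varphi(\pi_1))$ for $\varphi:A^{A\times X}\to A\times G(A\times X)$, is the right Kan extension of $FG$ along $F$; i.e., $\mathbb F$ is the familiar of $F$: for every endofunctor $H$ and every natural transformation $\theta:HF\Rightarrow FG$, the natural transformation $\hat\theta:H\Rightarrow\mathbb F(G)$ defined below is the unique one with $\epsilon\circ\hat\theta F=\theta$. (ii) The assignment $(\Sigma,\lambda)\mapsto(\Sigma,\hat\lambda)$ (with $H=G=\Sigma$), identity on morphisms, is a functor witnessing an isomorphism of categories $\mathrm{DL}(F)\cong\mathrm{Coalg}(\mathbb F)$.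
   Context: $\mathbb F(G)$ acts on a map $h:X\to Y$ by $\mathbb F(G)(h)(\varphi)(\varsigma)=(\mathrm{id}_A\times Gh)(\varphi(\varsigma\circ h))$ for $\varphi:A^X\to A\times GX$, $\varsigma:Y\to A$; on a natural transformation $\alpha:G\Rightarrow G'$, $\mathbb F(\alpha)_X=(\mathrm{id}_A\times\alpha_X)^{A^X}$. The costrength of a functor $H$ is $\mathrm{cs}^H_{B,Y}:H(Y^B)\to(HY)^B$, $\mathrm{cs}^H_{B,Y}(t)(b)=H(\epsilon^b)(t)$ where $\epsilon^b(g)=g(b)$. Let $c_X:X\to(A\times X)^{A^X}$, $c_X(x)(\varsigma)=(\varsigma(x),x)$. For $\theta:HF\Rightarrow FG$, $\hat\theta_X=(\theta_X)^{A^X}\circ\mathrm{cs}^H_{A^X,A\times X}\circ Hc_X:HX\to(A\times GX)^{A^X}$. $\mathrm{DL}(F)$ is the category whose objects are pairs $(\Sigma,\lambda)$ of an endofunctor $\Sigma$ on Set and a natural transformation $\lambda:\Sigma F\Rightarrow F\Sigma$, and whose morphisms $(\Sigma_1,\lambda_1)\to(\Sigma_2,\lambda_2)$ are natural transformations $\theta:\Sigma_1\Rightarrow\Sigma_2$ with $\lambda_2\circ\theta F=F\theta\circ\lambda_1$. $\mathrm{Coalg}(\mathbb F)$ has objects $(\Sigma,\delta:\Sigma\Rightarrow\mathbb F(\Sigma))$ and morphisms $\theta:\Sigma_1\Rightarrow\Sigma_2$ with $\mathbb F(\theta)\circ\delta_1=\delta_2\circ\theta$. The familiar of $F$ is defined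 as the functor $G\mapsto\mathrm{Ran}_F(FG)$ on the functor category $[\mathrm{Set},\mathrm{Set}]$. -}

module Defs where

open import Level using (0ℓ)
open import Function using (id; _∘_)
open import Data.Product using (_×_; _,_; proj₁; proj₂; map₂)
open import Relation.Binary.PropositionalEquality using (_≡_; refl; cong; trans)
open import Axiom.Extensionality.Propositional using (Extensionality)

record Endofunctor : Set₁ where
  field
    F₀   : Set → Set
    F₁   : ∀ {X Y : Set} → (X → Y) → F₀ X → F₀ Y
    F-id : ∀ {X : Set} (x : F₀ X) → F₁ id x ≡ x
    F-∘  : ∀ {X Y Z : Set} (f : X → Y) (g : Y → Z) (x : F₀ X) →
           F₁ (g ∘ f) x ≡ F₁ g (F₁ f x)
open Endofunctor public

Components : Endofunctor → Endofunctor → Set₁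
Components H K = ∀ (X : Set) → F₀ H X → F₀ K X

IsNatural : (H K : Endofunctor) → Components H K → Set₁
IsNatural H K η = ∀ {X Y : Set} (f : X → Y) (x : F₀ H X) →
  η Y (F₁ H f x) ≡ F₁ K f (η X x)

record NatTrans (H K : Endofunctor) : Set₁ where
  field
    η       : Components H K
    natural : IsNatural H K η
open NatTrans public

cs : (H : Endofunctor) (B Y : Set) → F₀ H (B → Y) → B → F₀ H Y
cs H B Y t b = F₁ H (λ g → g b) t

-- Everything below works in Set with function extensionality
-- (which holds in the classical category Set of the paper).
module Familiar (A : Set) (ext : Extensionality 0ℓ 0ℓ) where

  _∘F_ : Endofunctor → Endofunctor → Endofunctor
  K ∘F H = record
    { F₀   = λ X → F₀ K (F₀ H X)
    ; F₁   = λ f → F₁ K (F₁ H f)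
    ; F-id = λ x → trans (cong (λ g → F₁ K g x) (ext (F-id H))) (F-id K x)
    ; F-∘  = λ f g x → trans (cong (λ h → F₁ K h x) (ext (F-∘ H f g))) (F-∘ K (F₁ H f) (F₁ H g) x)
    }

  Fun : Endofunctor
  Fun = record
    { F₀   = λ X → A × X
    ; F₁   = λ f → map₂ f
    ; F-id = λ x → refl
    ; F-∘  = λ f g x → refl
    }

  𝔽₀ : Endofunctor → Set → Set
  𝔽₀ G X = (X → A) → A × F₀ G X

  𝔽₁ : (G : Endofunctor) {X Y : Set} → (X → Y) → 𝔽₀ G X → 𝔽₀ G Y
  𝔽₁ G h φ ς = map₂ (F₁ G h) (φ (ς ∘ h))

  𝔽 : Endofunctor → Endofunctor
  𝔽 G = record
    { F₀   = 𝔽₀ G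
    ; F₁   = 𝔽₁ G
    ; F-id = λ φ → ext (λ ς → cong (proj₁ (φ ς) ,_) (F-id G (proj₂ (φ ς))))
    ; F-∘  = λ f g φ → ext (λ ς →
               cong (proj₁ (φ (λ x → ς (g (f x)))) ,_)
                    (F-∘ G f g (proj₂ (φ (λ x → ς (g (f x)))))))
    }

  𝔽-map : (G G' : Endofunctor) → Components G G' → Components (𝔽 G) (𝔽 G')
  𝔽-map G G' α X φ ς = map₂ (α X) (φ ς)

  ε : (G : Endofunctor) → Components (𝔽 G ∘F Fun) (Fun ∘F G)
  ε G X φ = map₂ (F₁ G proj₂) (φ proj₁)

  c : (X : Set) → X → (X → A) → A × X
  c X x ς = (ς x , x)

  -- θ̂_X = (θ_X)^(A^X) ∘ cs^H_{A^X, A×X} ∘ H c_X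
  hat : (H G : Endofunctor) → Components (H ∘F Fun) (Fun ∘F G) → Components H (𝔽 G)
  hat H G θ X x = λ ς → θ X (cs H (X → A) (A × X) (F₁ H (c X) x) ς)

  IsDLMor : (Σ₁ Σ₂ : Endofunctor) →
            Components (Σ₁ ∘F Fun) (Fun ∘F Σ₁) → Components (Σ₂ ∘F Fun) (Fun ∘F Σ₂) →
            Components Σ₁ Σ₂ → Set₁
  IsDLMor Σ₁ Σ₂ λ₁ λ₂ θ = ∀ (X : Set) (x : F₀ Σ₁ (A × X)) →
    λ₂ X (θ (A × X) x) ≡ map₂ (θ X) (λ₁ X x)

  IsCoalgMor : (Σ₁ Σ₂ : Endofunctor) →
               Components Σ₁ (𝔽 Σ₁) → Components Σ₂ (𝔽 Σ₂) →
               Components Σ₁ Σ₂ → Set₁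
  IsCoalgMor Σ₁ Σ₂ δ₁ δ₂ θ = ∀ (X : Set) (x : F₀ Σ₁ X) →
    𝔽-map Σ₁ Σ₂ θ X (δ₁ X x) ≡ δ₂ X (θ X x)

-- The single idea: for ς : X → A the map tag ς = ⟨ς , id⟩ : X → A × X turns a
-- component of 𝔽(G) at X into one at A × X, and ε recovers the value at ς from it
-- (ε-tag).  Hence a transformation into 𝔽(G) is determined by its composite with ε,
-- which gives uniqueness; θ̂ evaluated at ς is θ applied to H(tag ς), which gives
-- existence.  Part (ii) follows, since λ ↦ λ̂ is inverted by δ ↦ ε ∘ δF.
module Submission where

open import Defs
open import Level using (0ℓ)
open import Function using (id; _∘_)
open import Data.Product using (_×_; _,_; proj₁; proj₂; map₂; Σ-syntax)
open import Relation.Binary.PropositionalEquality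
  using (_≡_; refl; sym; cong; module ≡-Reasoning)
open import Axiom.Extensionality.Propositional using (Extensionality)
open import Function.Bundles using (_⇔_; mk⇔)

module FamiliarProperties (A : Set) (ext : Extensionality 0ℓ 0ℓ) where
  open Familiar A ext
  open ≡-Reasoning

  tag : {X : Set} → (X → A) → X → A × X
  tag ς x = c _ x ς

  hat-tag : (H G : Endofunctor) (θ : Components (H ∘F Fun) (Fun ∘F G))
            (X : Set) (x : F₀ H X) (ς : X → A) →
            hat H G θ X x ς ≡ θ X (F₁ H (tag ς) x)
  hat-tag H G θ X x ς = cong (θ X) (sym (F-∘ H (c X) (λ g → g ς) x))

  ε-tag : (G : Endofunctor) {X : Set} (φ : F₀ (𝔽 G) X) (ς : X → A) →
          ε G X (𝔽₁ G (tag ς) φ) ≡ φ ς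
  ε-tag G φ ς = cong (proj₁ (φ ς) ,_) (begin
    F₁ G proj₂ (F₁ G (tag ς) (proj₂ (φ ς))) ≡⟨ F-∘ G (tag ς) proj₂ (proj₂ (φ ς)) ⟨
    F₁ G id (proj₂ (φ ς))                   ≡⟨ F-id G (proj₂ (φ ς)) ⟩
    proj₂ (φ ς)                             ∎)

  ε-natural : (G : Endofunctor) → IsNatural (𝔽 G ∘F Fun) (Fun ∘F G) (ε G)
  ε-natural G f φ = cong (proj₁ (φ proj₁) ,_) (begin
    F₁ G proj₂ (F₁ G (map₂ f) t) ≡⟨ F-∘ G (map₂ f) proj₂ t ⟨
    F₁ G (f ∘ proj₂) t           ≡⟨ F-∘ G proj₂ f t ⟩
    F₁ G f (F₁ G proj₂ t)        ∎)
    where t = proj₂ (φ proj₁)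

  ε-𝔽-map : (G G′ : Endofunctor) (α : NatTrans G G′) (X : Set) (φ : F₀ (𝔽 G) (A × X)) →
            ε G′ X (𝔽-map G G′ (η α) (A × X) φ) ≡ map₂ (η α X) (ε G X φ)
  ε-𝔽-map G G′ α X φ = cong (proj₁ (φ proj₁) ,_) (sym (natural α proj₂ (proj₂ (φ proj₁))))

  module _ (H G : Endofunctor) (θ : NatTrans (H ∘F Fun) (Fun ∘F G)) where

    hat-natural : IsNatural H (𝔽 G) (hat H G (η θ))
    hat-natural {X} {Y} f x = ext λ ς → begin
      hat H G (η θ) Y (F₁ H f x) ς                     ≡⟨ hat-tag H G (η θ) Y (F₁ H f x) ς ⟩
      η θ Y (F₁ H (tag ς) (F₁ H f x))                  ≡⟨ cong (η θ Y) (F-∘ H f (tag ς) x) ⟨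
      η θ Y (F₁ H (map₂ f ∘ tag (ς ∘ f)) x)            ≡⟨ cong (η θ Y) (F-∘ H (tag (ς ∘ f)) (map₂ f) x) ⟩
      η θ Y (F₁ H (map₂ f) (F₁ H (tag (ς ∘ f)) x))     ≡⟨ natural θ f (F₁ H (tag (ς ∘ f)) x) ⟩
      map₂ (F₁ G f) (η θ X (F₁ H (tag (ς ∘ f)) x))     ≡⟨ cong (map₂ (F₁ G f)) (hat-tag H G (η θ) X x (ς ∘ f)) ⟨
      𝔽₁ G f (hat H G (η θ) X x) ς                     ∎

    ε-hat : (X : Set) (x : F₀ H (A × X)) → ε G X (hat H G (η θ) (A × X) x) ≡ η θ X x
    ε-hat X x = begin
      map₂ (F₁ G proj₂) (hat H G (η θ) (A × X) x proj₁)        ≡⟨ cong (map₂ (F₁ G proj₂)) (hat-tag H G (η θ) (A × X) x proj₁) ⟩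
      map₂ (F₁ G proj₂) (η θ (A × X) (F₁ H (tag proj₁) x))     ≡⟨ natural θ proj₂ (F₁ H (tag proj₁) x) ⟨
      η θ X (F₁ H (map₂ proj₂) (F₁ H (tag proj₁) x))           ≡⟨ cong (η θ X) (F-∘ H (tag proj₁) (map₂ proj₂) x) ⟨
      η θ X (F₁ H id x)                                        ≡⟨ cong (η θ X) (F-id H x) ⟩
      η θ X x                                                  ∎

    hat-unique : (β : NatTrans H (𝔽 G)) →
                 ((X : Set) (x : F₀ H (A × X)) → ε G X (η β (A × X) x) ≡ η θ X x) →
                 (X : Set) (x : F₀ H X) → η β X x ≡ hat H G (η θ) X x
    hat-unique β ε∘βF≡θ X x = ext λ ς → begin
      η β X x ς                           ≡⟨ ε-tag G (η β X x) ς ⟨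
      ε G X (𝔽₁ G (tag ς) (η β X x))      ≡⟨ cong (ε G X) (natural β (tag ς) x) ⟨
      ε G X (η β (A × X) (F₁ H (tag ς) x)) ≡⟨ ε∘βF≡θ X (F₁ H (tag ς) x) ⟩
      η θ X (F₁ H (tag ς) x)              ≡⟨ hat-tag H G (η θ) X x ς ⟨
      hat H G (η θ) X x ς                 ∎

  unhat : (Σ₁ : Endofunctor) → NatTrans Σ₁ (𝔽 Σ₁) → NatTrans (Σ₁ ∘F Fun) (Fun ∘F Σ₁)
  unhat Σ₁ δ = record
    { η       = λ X x → ε Σ₁ X (η δ (A × X) x)
    ; natural = λ {X} {Y} f x → begin
        ε Σ₁ Y (η δ (A × Y) (F₁ Σ₁ (map₂ f) x))  ≡⟨ cong (ε Σ₁ Y) (natural δ (map₂ f) x) ⟩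
        ε Σ₁ Y (𝔽₁ Σ₁ (map₂ f) (η δ (A × X) x))  ≡⟨ ε-natural Σ₁ f (η δ (A × X) x) ⟩
        map₂ (F₁ Σ₁ f) (ε Σ₁ X (η δ (A × X) x))  ∎
    }

  hat-unhat : (Σ₁ : Endofunctor) (δ : NatTrans Σ₁ (𝔽 Σ₁)) (X : Set) (x : F₀ Σ₁ X) →
              hat Σ₁ Σ₁ (η (unhat Σ₁ δ)) X x ≡ η δ X x
  hat-unhat Σ₁ δ X x = sym (hat-unique Σ₁ Σ₁ (unhat Σ₁ δ) δ (λ _ _ → refl) X x)

  hat-injective : (Σ₁ : Endofunctor) (lam₁ lam₂ : NatTrans (Σ₁ ∘F Fun) (Fun ∘F Σ₁)) →
                  ((X : Set) (x : F₀ Σ₁ X) → hat Σ₁ Σ₁ (η lam₁) X x ≡ hat Σ₁ Σ₁ (η lam₂) X x) →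
                  (X : Set) (x : F₀ Σ₁ (A × X)) → η lam₁ X x ≡ η lam₂ X x
  hat-injective Σ₁ lam₁ lam₂ hat₁≡hat₂ X x = begin
    η lam₁ X x                             ≡⟨ ε-hat Σ₁ Σ₁ lam₁ X x ⟨
    ε Σ₁ X (hat Σ₁ Σ₁ (η lam₁) (A × X) x)  ≡⟨ cong (ε Σ₁ X) (hat₁≡hat₂ (A × X) x) ⟩
    ε Σ₁ X (hat Σ₁ Σ₁ (η lam₂) (A × X) x)  ≡⟨ ε-hat Σ₁ Σ₁ lam₂ X x ⟩
    η lam₂ X x                             ∎

  module _ (Σ₁ Σ₂ : Endofunctor) (lam₁ : NatTrans (Σ₁ ∘F Fun) (Fun ∘F Σ₁))
           (lam₂ : NatTrans (Σ₂ ∘F Fun) (Fun ∘F Σ₂)) (θ : NatTrans Σ₁ Σ₂) where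

    DLMor⇒CoalgMor : IsDLMor Σ₁ Σ₂ (η lam₁) (η lam₂) (η θ) →
                     IsCoalgMor Σ₁ Σ₂ (hat Σ₁ Σ₁ (η lam₁)) (hat Σ₂ Σ₂ (η lam₂)) (η θ)
    DLMor⇒CoalgMor dl X x = ext λ ς → begin
      map₂ (η θ X) (hat Σ₁ Σ₁ (η lam₁) X x ς)          ≡⟨ cong (map₂ (η θ X)) (hat-tag Σ₁ Σ₁ (η lam₁) X x ς) ⟩
      map₂ (η θ X) (η lam₁ X (F₁ Σ₁ (tag ς) x))        ≡⟨ dl X (F₁ Σ₁ (tag ς) x) ⟨
      η lam₂ X (η θ (A × X) (F₁ Σ₁ (tag ς) x))         ≡⟨ cong (η lam₂ X) (natural θ (tag ς) x) ⟩
      η lam₂ X (F₁ Σ₂ (tag ς) (η θ X x))               ≡⟨ hat-tag Σ₂ Σ₂ (η lam₂) X (η θ X x) ς ⟨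
      hat Σ₂ Σ₂ (η lam₂) X (η θ X x) ς                 ∎

    CoalgMor⇒DLMor : IsCoalgMor Σ₁ Σ₂ (hat Σ₁ Σ₁ (η lam₁)) (hat Σ₂ Σ₂ (η lam₂)) (η θ) →
                     IsDLMor Σ₁ Σ₂ (η lam₁) (η lam₂) (η θ)
    CoalgMor⇒DLMor co X x = begin
      η lam₂ X (η θ (A × X) x)                                          ≡⟨ ε-hat Σ₂ Σ₂ lam₂ X (η θ (A × X) x) ⟨
      ε Σ₂ X (hat Σ₂ Σ₂ (η lam₂) (A × X) (η θ (A × X) x))               ≡⟨ cong (ε Σ₂ X) (co (A × X) x) ⟨
      ε Σ₂ X (𝔽-map Σ₁ Σ₂ (η θ) (A × X) (hat Σ₁ Σ₁ (η lam₁) (A × X) x)) ≡⟨ ε-𝔽-map Σ₁ Σ₂ θ X (hat Σ₁ Σ₁ (η lam₁) (A × X) x) ⟩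
      map₂ (η θ X) (ε Σ₁ X (hat Σ₁ Σ₁ (η lam₁) (A × X) x))              ≡⟨ cong (map₂ (η θ X)) (ε-hat Σ₁ Σ₁ lam₁ X x) ⟩
      map₂ (η θ X) (η lam₁ X x)                                         ∎

theorem7 : (A : Set) (ext : Extensionality 0ℓ 0ℓ) →
    let open Familiar A ext in
    -- (i) (𝔽(G), ε) is the right Kan extension of FG along F, with mediating map θ̂
    ((G : Endofunctor) →
      IsNatural (𝔽 G ∘F Fun) (Fun ∘F G) (ε G)
      × ((H : Endofunctor) (θ : NatTrans (H ∘F Fun) (Fun ∘F G)) →
          IsNatural H (𝔽 G) (hat H G (η θ))
          × ((X : Set) (x : F₀ H (A × X)) → ε G X (hat H G (η θ) (A × X) x) ≡ η θ X x)
          × ((β : NatTrans H (𝔽 G)) →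
              ((X : Set) (x : F₀ H (A × X)) → ε G X (η β (A × X) x) ≡ η θ X x) →
              (X : Set) (x : F₀ H X) → η β X x ≡ hat H G (η θ) X x)))
    -- (ii) (Σ, λ) ↦ (Σ, λ̂), identity on morphisms, is an isomorphism DL(F) ≅ Coalg(𝔽)
    × (((Σ₁ : Endofunctor) (lam : NatTrans (Σ₁ ∘F Fun) (Fun ∘F Σ₁)) →
          IsNatural Σ₁ (𝔽 Σ₁) (hat Σ₁ Σ₁ (η lam)))
      × ((Σ₁ : Endofunctor) (δ : NatTrans Σ₁ (𝔽 Σ₁)) →
          Σ[ lam ∈ NatTrans (Σ₁ ∘F Fun) (Fun ∘F Σ₁) ]
            ((X : Set) (x : F₀ Σ₁ X) → hat Σ₁ Σ₁ (η lam) X x ≡ η δ X x))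
      × ((Σ₁ : Endofunctor) (lam₁ lam₂ : NatTrans (Σ₁ ∘F Fun) (Fun ∘F Σ₁)) →
          ((X : Set) (x : F₀ Σ₁ X) → hat Σ₁ Σ₁ (η lam₁) X x ≡ hat Σ₁ Σ₁ (η lam₂) X x) →
          (X : Set) (x : F₀ Σ₁ (A × X)) → η lam₁ X x ≡ η lam₂ X x)
      × ((Σ₁ Σ₂ : Endofunctor) (lam₁ : NatTrans (Σ₁ ∘F Fun) (Fun ∘F Σ₁))
         (lam₂ : NatTrans (Σ₂ ∘F Fun) (Fun ∘F Σ₂)) (θ : NatTrans Σ₁ Σ₂) →
          IsDLMor Σ₁ Σ₂ (η lam₁) (η lam₂) (η θ)
            ⇔ IsCoalgMor Σ₁ Σ₂ (hat Σ₁ Σ₁ (η lam₁)) (hat Σ₂ Σ₂ (η lam₂)) (η θ)))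
theorem7 A ext =
  ( λ G → ε-natural G
        , λ H θ → hat-natural H G θ , ε-hat H G θ , hat-unique H G θ )
  , (λ Σ₁ lam → hat-natural Σ₁ Σ₁ lam)
  , (λ Σ₁ δ → unhat Σ₁ δ , hat-unhat Σ₁ δ)
  , hat-injective
  , (λ Σ₁ Σ₂ lam₁ lam₂ θ → mk⇔ (DLMor⇒CoalgMor Σ₁ Σ₂ lam₁ lam₂ θ) (CoalgMor⇒DLMor Σ₁ Σ₂ lam₁ lam₂ θ))
  where open FamiliarProperties A ext
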